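{- Let $N$ be an odd prime, $\zeta=e^{2\pi i/N}$ and $O=\mathbb{Z}[\zeta]$. Suppose $\beta\in O$ and $\gamma\in O$ are such that $\beta$ and $\beta\gamma$ are both binary and have the same autocorrelation, $\beta\overline{\beta}=(\beta\gamma)\overline{(\beta\gamma)}$. Then $\gamma=\pm\zeta^k$ for some integer $k$.
   Context: Elements of $O=\mathbb{Z}[\zeta]$ are written in the basis $\zeta,\zeta^2,\dots,\zeta^{N-1}$ as $\alpha=\sum_{i=1}^{N-1}[\alpha]_i\zeta^i$. An element $\beta\in O$ is binary if $\beta\ne 0$ and either all coordinates $[\beta]_i$ ($1\le i\le N-1$) lie in $\{0,1\}$ or all lie in $\{ -1,0\}$. The overbar denotes complex conjugation (the automorphism $\zeta\mapsto\zeta^{ -1}$); $\beta\overline\beta$ is the autocorrelation of $\beta$. -}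

module Defs where

open import Data.Nat using (ℕ; zero; suc; _∸_; _≤_; _<_; NonZero; _%_)
import Data.Nat as ℕ
open import Data.Nat.DivMod using (m%n<n)
open import Data.Fin using (Fin; toℕ; fromℕ<)
open import Data.Fin.Properties using () renaming (_≟_ to _≟ᶠ_)
open import Data.Integer using (ℤ; _+_; _*_; _-_; -_; 0ℤ; 1ℤ; -1ℤ)
open import Data.Product using (_×_)
open import Data.Sum using (_⊎_)
open import Relation.Binary.PropositionalEquality using (_≡_)
open import Relation.Nullary using (¬_; yes; no)

sumF : ∀ {n} → (Fin n → ℤ) → ℤ
sumF {zero}  f = 0ℤ
sumF {suc n} f = f Fin.zero + sumF (λ i → f (Fin.suc i))

-- Elements of O = ℤ[ζ] (ζ a primitive N-th root of unity, N prime) are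
-- represented by coefficient vectors a : Fin N → ℤ meaning Σ_{j<N} a_j ζ^j.
-- This is a surjection ℤ[x]/(x^N-1) → O whose kernel is ℤ·(1+x+…+x^{N-1});
-- equality in O is handled by the coordinates [α]_i in the basis ζ,…,ζ^{N-1}:
-- [α]_i = a_i - a_0  (1 ≤ i ≤ N-1), using ζ^0 = -(ζ+…+ζ^{N-1}).
module _ (N : ℕ) .{{_ : NonZero N}} where

  idx : ℕ → Fin N
  idx m = fromℕ< (m%n<n m N)

  Elt : Set
  Elt = Fin N → ℤ

  ζ^ : ℕ → Elt
  ζ^ k j with j ≟ᶠ idx k
  ... | yes _ = 1ℤ
  ... | no  _ = 0ℤ

  0ᴼ : Elt
  0ᴼ _ = 0ℤ

  negᴼ : Elt → Elt
  negᴼ a j = - a j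

  -- multiplication (cyclic convolution, since ζ^N = 1)
  _·_ : Elt → Elt → Elt
  (a · b) k = sumF (λ i → a i * b (idx (toℕ k ℕ.+ (N ∸ toℕ i))))

  -- complex conjugation ζ ↦ ζ^{-1}
  conj : Elt → Elt
  conj a k = a (idx (N ∸ toℕ k))

  coord : Elt → ℕ → ℤ
  coord a i = a (idx i) - a (idx 0)

  _≈_ : Elt → Elt → Set
  a ≈ b = ∀ i → 1 ≤ i → i < N → coord a i ≡ coord b i

  IsBinary : Elt → Set
  IsBinary β =
    ¬ (β ≈ 0ᴼ) ×
    ((∀ i → 1 ≤ i → i < N → coord β i ≡ 0ℤ ⊎ coord β i ≡ 1ℤ)
     ⊎ (∀ i → 1 ≤ i → i < N → coord β i ≡ -1ℤ ⊎ coord β i ≡ 0ℤ))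

{-# OPTIONS --safe #-}
module Submission where

-- Let b, g be the coefficient vectors of β, γ, extended N-periodically, ⊛ cyclic convolution,
-- f̄(k) = f(−k) and δ the unit vector at 0. The autocorrelations of β and βγ have coefficients
-- A = b ⊛ b̄ and A ⊛ G with G = g ⊛ ḡ; equality in O is equality up to a constant vector, so
-- A ⊛ (G − δ) is constant. Since β is binary, N ∤ β(1), hence N ∤ A(1) = β(1)². Then A is a
-- unit modulo N, because the shift T satisfies (T − 1)^N ≡ 0 (mod N), and by descent A can be
-- cancelled over ℤ: G − δ is a constant c, i.e. γγ̄ = 1. Now G(0) = Σ g² = 1 + c and
-- Σ G = (Σ g)² = 1 + Nc, so Σ g = ε + tN with ε = ±1, and together these give Σ (g − t)² = 1.
-- Hence g − t is ± a unit vector, i.e. γ = ±ζ^k.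

open import Defs
import Data.Integer.Properties as ℤP
import Data.Nat.Properties as ℕP
open import Algebra.Properties.AbelianGroup ℤP.+-0-abelianGroup using () renaming (∙-cancelʳ to +-cancelʳ)
open import Algebra.Properties.Ring ℤP.+-*-ring using (x[y-z]≈xy-xz)
open import Algebra.Properties.Semiring.Sum ℤP.+-*-semiring
  using (sum; sum-cong-≗; ∑-distrib-+; ∑-comm; *-distribˡ-sum; *-distribʳ-sum)
import Algebra.Properties.Semiring.Sum ℕP.+-*-semiring as ℕΣ
open import Data.Empty using (⊥-elim)
open import Data.Fin as Fin using (Fin; toℕ)
import Data.Fin.Properties as FinP
open import Data.Integer as ℤ using (ℤ; +_; -[1+_]; _+_; _*_; _-_; -_; _^_; 0ℤ; 1ℤ; -1ℤ)
open import Data.Integer.Divisibility.Signed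
  using (_∣_; divides; ∣⇒∣ᵤ; ∣ᵤ⇒∣; ∣-refl; ∣m∣n⇒∣m+n; ∣m∣n⇒∣m-n; ∣m+n∣m⇒∣n; ∣m⇒∣-m; ∣n⇒∣m*n; ∣m⇒∣m*n)
import Data.Integer.Tactic.RingSolver as ℤSolver
open import Data.Nat using (ℕ; NonZero; _%_)
open import Data.Nat as ℕ using (zero; suc; _∸_; z≤n; s≤s)
open import Data.Nat.Combinatorics using (_C_; nCn≡1; nC1≡n; nCk+nC[k+1]≡[n+1]C[k+1])
open import Data.Nat.Combinatorics.Specification using (k>n⇒nCk≡0)
import Data.Nat.Divisibility as ℕ∣
open import Data.Nat.DivMod using (m≡m%n+[m/n]*n; m%n<n; m<n⇒m%n≡m; [m+kn]%n≡m%n; m%n%n≡m%n)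
open import Data.Nat.Primality using (Prime; ¬prime[0]; euclidsLemma; prime⇒nonTrivial)
import Data.Nat.Tactic.RingSolver as ℕSolver
open import Data.Product using (∃; ∃₂; _×_; _,_)
open import Data.Sum using (_⊎_; inj₁; inj₂; fromInj₂; reduce)
open import Function using (_∘_)
open import Relation.Binary.PropositionalEquality
  using (_≡_; _≢_; _≗_; refl; sym; trans; cong; cong₂; subst; module ≡-Reasoning)
open import Relation.Nullary using (¬_; yes; no)

∑< : ℕ → (ℕ → ℤ) → ℤ
∑< n f = sum (λ (i : Fin n) → f (toℕ i))

∑<-cong : ∀ n {f g : ℕ → ℤ} → (∀ i → i ℕ.< n → f i ≡ g i) → ∑< n f ≡ ∑< n g
∑<-cong n f≡g = sum-cong-≗ {n} (λ i → f≡g (toℕ i) (FinP.toℕ<n i))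

∑<-cong-≗ : ∀ n {f g : ℕ → ℤ} → f ≗ g → ∑< n f ≡ ∑< n g
∑<-cong-≗ n f≗g = sum-cong-≗ {n} (f≗g ∘ toℕ)

∑<-distrib-+ : ∀ n (f g : ℕ → ℤ) → ∑< n (λ i → f i + g i) ≡ ∑< n f + ∑< n g
∑<-distrib-+ n f g = ∑-distrib-+ {n} (f ∘ toℕ) (g ∘ toℕ)

*-distribˡ-∑< : ∀ n c (f : ℕ → ℤ) → c * ∑< n f ≡ ∑< n (λ i → c * f i)
*-distribˡ-∑< n c f = *-distribˡ-sum {n} c (f ∘ toℕ)

*-distribʳ-∑< : ∀ n c (f : ℕ → ℤ) → ∑< n f * c ≡ ∑< n (λ i → f i * c)
*-distribʳ-∑< n c f = *-distribʳ-sum {n} c (f ∘ toℕ)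

∑<-comm : ∀ m n (f : ℕ → ℕ → ℤ) → ∑< m (λ i → ∑< n (f i)) ≡ ∑< n (λ j → ∑< m (λ i → f i j))
∑<-comm m n f = ∑-comm {m} {n} (λ i j → f (toℕ i) (toℕ j))

∑<-neg : ∀ n (f : ℕ → ℤ) → ∑< n (λ i → - f i) ≡ - ∑< n f
∑<-neg n f = begin
  ∑< n (λ i → - f i)       ≡⟨ ∑<-cong-≗ n (λ i → sym (ℤP.-1*i≡-i (f i))) ⟩
  ∑< n (λ i → -1ℤ * f i)   ≡⟨ *-distribˡ-∑< n -1ℤ f ⟨
  -1ℤ * ∑< n f             ≡⟨ ℤP.-1*i≡-i _ ⟩
  - ∑< n f                 ∎
  where open ≡-Reasoning

∑<-distrib-- : ∀ n (f g : ℕ → ℤ) → ∑< n (λ i → f i - g i) ≡ ∑< n f - ∑< n g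
∑<-distrib-- n f g = trans (∑<-distrib-+ n f (λ i → - g i)) (cong (λ s → ∑< n f + s) (∑<-neg n g))

∑<-const : ∀ n c → ∑< n (λ _ → c) ≡ + n * c
∑<-const zero    c = sym (ℤP.*-zeroˡ c)
∑<-const (suc n) c = begin
  c + ∑< n (λ _ → c)  ≡⟨ cong (_+_ c) (∑<-const n c) ⟩
  c + + n * c         ≡⟨ ℤP.suc-* (+ n) c ⟨
  + suc n * c         ∎
  where open ≡-Reasoning

∑<-zero : ∀ n → ∑< n (λ _ → 0ℤ) ≡ 0ℤ
∑<-zero n = trans (∑<-const n 0ℤ) (ℤP.*-zeroʳ (+ n))

∑<-init-last : ∀ n (f : ℕ → ℤ) → ∑< (suc n) f ≡ ∑< n f + f n
∑<-init-last zero    f = ℤP.+-comm (f 0) 0ℤ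
∑<-init-last (suc n) f =
  trans (cong (_+_ (f 0)) (∑<-init-last n (f ∘ suc))) (sym (ℤP.+-assoc (f 0) _ _))

∑<-reverse : ∀ n (f : ℕ → ℤ) → ∑< n f ≡ ∑< n (λ i → f (n ∸ suc i))
∑<-reverse zero    f = refl
∑<-reverse (suc n) f = begin
  ∑< (suc n) f                         ≡⟨ ∑<-init-last n f ⟩
  ∑< n f + f n                         ≡⟨ cong (_+ f n) (∑<-reverse n f) ⟩
  ∑< n (λ i → f (n ∸ suc i)) + f n     ≡⟨ ℤP.+-comm _ (f n) ⟩
  f n + ∑< n (λ i → f (n ∸ suc i))     ∎
  where open ≡-Reasoning

∣-∑< : ∀ {d} n {f : ℕ → ℤ} → (∀ i → i ℕ.< n → d ∣ f i) → d ∣ ∑< n f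
∣-∑< zero    d∣f = divides 0ℤ refl
∣-∑< (suc n) d∣f = ∣m∣n⇒∣m+n (d∣f 0 (s≤s z≤n)) (∣-∑< n (λ i i<n → d∣f (suc i) (s≤s i<n)))

sumF≡∑< : ∀ n (f : Fin n → ℤ) (g : ℕ → ℤ) → (∀ i → f i ≡ g (toℕ i)) → sumF f ≡ ∑< n g
sumF≡∑< zero    f g f≡g = refl
sumF≡∑< (suc n) f g f≡g =
  cong₂ _+_ (f≡g Fin.zero) (sumF≡∑< n (f ∘ Fin.suc) (g ∘ suc) (f≡g ∘ Fin.suc))

euclidsLemmaℤ : ∀ {p} → Prime p → ∀ x y → + p ∣ x * y → + p ∣ x ⊎ + p ∣ y
euclidsLemmaℤ pp x y p∣xy
  with euclidsLemma ℤ.∣ x ∣ ℤ.∣ y ∣ pp (subst (ℕ∣._∣_ _) (ℤP.abs-* x y) (∣⇒∣ᵤ p∣xy))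
... | inj₁ p∣x = inj₁ (∣ᵤ⇒∣ p∣x)
... | inj₂ p∣y = inj₂ (∣ᵤ⇒∣ p∣y)

m*n≤1+r⇒m≤r : ∀ {m n r} → 1 ℕ.< n → m ℕ.* n ℕ.≤ suc r → m ℕ.≤ r
m*n≤1+r⇒m≤r {zero}      _   _        = z≤n
m*n≤1+r⇒m≤r {suc m} {n} 1<n m*n≤1+r = ℕP.≤-pred (ℕP.<-≤-trans (ℕP.m<m*n (suc m) n 1<n) m*n≤1+r)

∣∧∣x∣<⇒x≡0 : ∀ {n x} → + n ∣ x → ℤ.∣ x ∣ ℕ.< n → x ≡ 0ℤ
∣∧∣x∣<⇒x≡0 {n} {x} n∣x ∣x∣<n with ℤ.∣ x ∣ in ∣x∣≡
... | zero  = ℤP.∣i∣≡0⇒i≡0 ∣x∣≡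
... | suc _ = ⊥-elim (ℕP.<⇒≱ ∣x∣<n (ℕ∣.∣⇒≤ (subst (ℕ∣._∣_ n) ∣x∣≡ (∣⇒∣ᵤ n∣x))))

[1+k]*[1+n]C[1+k]≡[1+n]*nCk : ∀ n k → suc k ℕ.* (suc n C suc k) ≡ suc n ℕ.* (n C k)
[1+k]*[1+n]C[1+k]≡[1+n]*nCk zero    zero    = refl
[1+k]*[1+n]C[1+k]≡[1+n]*nCk zero    (suc k) = begin
  suc (suc k) ℕ.* (1 C suc (suc k))  ≡⟨ cong (suc (suc k) ℕ.*_) (k>n⇒nCk≡0 {1} {suc (suc k)} (s≤s (s≤s z≤n))) ⟩
  suc (suc k) ℕ.* 0                  ≡⟨ ℕP.*-zeroʳ (suc (suc k)) ⟩
  0                                  ≡⟨ cong (1 ℕ.*_) (k>n⇒nCk≡0 {0} {suc k} (s≤s z≤n)) ⟨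
  1 ℕ.* (0 C suc k)                  ∎
  where open ≡-Reasoning
[1+k]*[1+n]C[1+k]≡[1+n]*nCk (suc n) zero    =
  trans (ℕP.*-identityˡ _) (trans (nC1≡n (suc (suc n))) (sym (ℕP.*-identityʳ _)))
[1+k]*[1+n]C[1+k]≡[1+n]*nCk (suc n) (suc k) = begin
  suc (suc k) ℕ.* (suc (suc n) C suc (suc k))
    ≡⟨ cong (suc (suc k) ℕ.*_) (nCk+nC[k+1]≡[n+1]C[k+1] (suc n) (suc k)) ⟨
  suc (suc k) ℕ.* (a ℕ.+ b)
    ≡⟨ regroupˡ k a b ⟩
  suc k ℕ.* a ℕ.+ a ℕ.+ suc (suc k) ℕ.* b
    ≡⟨ cong₂ (λ x y → x ℕ.+ a ℕ.+ y) ([1+k]*[1+n]C[1+k]≡[1+n]*nCk n k)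
                                       ([1+k]*[1+n]C[1+k]≡[1+n]*nCk n (suc k)) ⟩
  suc n ℕ.* (n C k) ℕ.+ a ℕ.+ suc n ℕ.* (n C suc k)
    ≡⟨ regroupʳ n (n C k) a (n C suc k) ⟩
  a ℕ.+ suc n ℕ.* (n C k ℕ.+ n C suc k)
    ≡⟨ cong (λ x → a ℕ.+ suc n ℕ.* x) (nCk+nC[k+1]≡[n+1]C[k+1] n k) ⟩
  suc (suc n) ℕ.* a ∎
  where
  open ≡-Reasoning
  a = suc n C suc k
  b = suc n C suc (suc k)
  regroupˡ : ∀ k a b → suc (suc k) ℕ.* (a ℕ.+ b) ≡ suc k ℕ.* a ℕ.+ a ℕ.+ suc (suc k) ℕ.* b
  regroupˡ = ℕSolver.solve-∀
  regroupʳ : ∀ n x a y → suc n ℕ.* x ℕ.+ a ℕ.+ suc n ℕ.* y ≡ a ℕ.+ suc n ℕ.* (x ℕ.+ y)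
  regroupʳ = ℕSolver.solve-∀

p∣pCk : ∀ {p} → Prime p → ∀ k → 0 ℕ.< k → k ℕ.< p → p ℕ∣.∣ p C k
p∣pCk {suc n} pp (suc k) _ k<p
  with euclidsLemma (suc k) (suc n C suc k) pp
         (ℕ∣.divides (n C k) (trans ([1+k]*[1+n]C[1+k]≡[1+n]*nCk n k) (ℕP.*-comm (suc n) (n C k))))
... | inj₁ p∣k = ⊥-elim (ℕP.<⇒≱ k<p (ℕ∣.∣⇒≤ p∣k))
... | inj₂ p∣C = p∣C

Δ : (ℕ → ℤ) → ℕ → ℤ
Δ f k = f (suc k) - f k

Δ^ : ℕ → (ℕ → ℤ) → ℕ → ℤ
Δ^ zero    f = f
Δ^ (suc j) f = Δ (Δ^ j f)

∣-Δ^ : ∀ {d f} → (∀ k → d ∣ f k) → ∀ j k → d ∣ Δ^ j f k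
∣-Δ^ d∣f zero    k = d∣f k
∣-Δ^ d∣f (suc j) k = ∣m∣n⇒∣m-n (∣-Δ^ d∣f j (suc k)) (∣-Δ^ d∣f j k)

∣-Δ⇒∣-telescope : ∀ {d f} → (∀ k → d ∣ Δ f k) → ∀ k → d ∣ f k - f 0
∣-Δ⇒∣-telescope {f = f} d∣Δf zero    = subst (_ ∣_) (sym (ℤP.+-inverseʳ (f 0))) (divides 0ℤ refl)
∣-Δ⇒∣-telescope {f = f} d∣Δf (suc k) =
  subst (_ ∣_) (ℤP.+-minus-telescope (f (suc k)) (f k) (f 0))
    (∣m∣n⇒∣m+n (d∣Δf k) (∣-Δ⇒∣-telescope {f = f} d∣Δf k))

signedBinomialSum : ℕ → (ℕ → ℤ) → ℕ → ℤ
signedBinomialSum j f k = ∑< (suc j) (λ i → -1ℤ ^ i * (+ (j C i) * f (k ℕ.+ i)))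

signedBinomialSum-suc : ∀ j f k →
  signedBinomialSum (suc j) f k ≡ signedBinomialSum j f k - signedBinomialSum j f (suc k)
signedBinomialSum-suc j f k = begin
  t 0 + ∑< (suc j) (λ i → -1ℤ ^ suc i * (+ (suc j C suc i) * f (k ℕ.+ suc i)))
    ≡⟨ cong (_+_ (t 0)) (trans (∑<-cong-≗ (suc j) pascal) (∑<-distrib-- (suc j) (t ∘ suc) v)) ⟩
  t 0 + (∑< (suc j) (t ∘ suc) - ∑< (suc j) v)
    ≡⟨ ℤP.+-assoc (t 0) _ _ ⟨
  ∑< (suc (suc j)) t - ∑< (suc j) v
    ≡⟨ cong (_- ∑< (suc j) v) (∑<-init-last (suc j) t) ⟩
  (∑< (suc j) t + t (suc j)) - ∑< (suc j) v
    ≡⟨ cong (λ x → (∑< (suc j) t + x) - ∑< (suc j) v) last-vanishes ⟩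
  (∑< (suc j) t + 0ℤ) - ∑< (suc j) v
    ≡⟨ cong (_- ∑< (suc j) v) (ℤP.+-identityʳ (∑< (suc j) t)) ⟩
  signedBinomialSum j f k - signedBinomialSum j f (suc k) ∎
  where
  open ≡-Reasoning
  t v : ℕ → ℤ
  t i = -1ℤ ^ i * (+ (j C i) * f (k ℕ.+ i))
  v i = -1ℤ ^ i * (+ (j C i) * f (suc k ℕ.+ i))
  split : ∀ s a b x → -1ℤ * s * ((a + b) * x) ≡ -1ℤ * s * (b * x) - s * (a * x)
  split = ℤSolver.solve-∀
  pascal : ∀ i → -1ℤ ^ suc i * (+ (suc j C suc i) * f (k ℕ.+ suc i)) ≡ t (suc i) - v i
  pascal i rewrite sym (nCk+nC[k+1]≡[n+1]C[k+1] j i) | ℕP.+-suc k i =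
    split (-1ℤ ^ i) (+ (j C i)) (+ (j C suc i)) (f (suc (k ℕ.+ i)))
  last-vanishes : t (suc j) ≡ 0ℤ
  last-vanishes rewrite k>n⇒nCk≡0 (ℕP.n<1+n j) = ℤP.*-zeroʳ (-1ℤ ^ suc j)

Δ^≡signedBinomialSum : ∀ j f k → Δ^ j f k ≡ -1ℤ ^ j * signedBinomialSum j f k
Δ^≡signedBinomialSum zero    f k = sym (trans (unit (f (k ℕ.+ 0))) (cong f (ℕP.+-identityʳ k)))
  where
  unit : ∀ a → 1ℤ * (1ℤ * (1ℤ * a) + 0ℤ) ≡ a
  unit = ℤSolver.solve-∀
Δ^≡signedBinomialSum (suc j) f k = begin
  Δ^ j f (suc k) - Δ^ j f k
    ≡⟨ cong₂ _-_ (Δ^≡signedBinomialSum j f (suc k)) (Δ^≡signedBinomialSum j f k) ⟩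
  s * signedBinomialSum j f (suc k) - s * signedBinomialSum j f k
    ≡⟨ factor s _ _ ⟩
  -1ℤ * s * (signedBinomialSum j f k - signedBinomialSum j f (suc k))
    ≡⟨ cong (-1ℤ * s *_) (signedBinomialSum-suc j f k) ⟨
  -1ℤ ^ suc j * signedBinomialSum (suc j) f k ∎
  where
  open ≡-Reasoning
  s = -1ℤ ^ j
  factor : ∀ s a b → s * a - s * b ≡ -1ℤ * s * (b - a)
  factor = ℤSolver.solve-∀

m-n≡p-q⇒m-p≡n-q : ∀ {m n p q} → m - n ≡ p - q → m - p ≡ n - q
m-n≡p-q⇒m-p≡n-q {m} {n} {p} {q} eq = begin
  m - p                        ≡⟨ regroup m n p q ⟩
  (m - n) - (p - q) + (n - q)  ≡⟨ cong (λ x → x - (p - q) + (n - q)) eq ⟩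
  (p - q) - (p - q) + (n - q)  ≡⟨ cong (_+ (n - q)) (ℤP.+-inverseʳ (p - q)) ⟩
  0ℤ + (n - q)                 ≡⟨ ℤP.+-identityˡ (n - q) ⟩
  n - q                        ∎
  where
  open ≡-Reasoning
  regroup : ∀ m n p q → m - p ≡ (m - n) - (p - q) + (n - q)
  regroup = ℤSolver.solve-∀

∑<-shifted-squares : ∀ n g t → ∑< n (λ m → (g m - t) * (g m - t))
                               ≡ ∑< n (λ m → g m * g m) - + 2 * t * ∑< n g + + n * (t * t)
∑<-shifted-squares n g t = begin
  ∑< n (λ m → (g m - t) * (g m - t))
    ≡⟨ ∑<-cong-≗ n (λ m → square (g m) t) ⟩
  ∑< n (λ m → (g m * g m - + 2 * t * g m) + t * t)
    ≡⟨ ∑<-distrib-+ n (λ m → g m * g m - + 2 * t * g m) (λ _ → t * t) ⟩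
  ∑< n (λ m → g m * g m - + 2 * t * g m) + ∑< n (λ _ → t * t)
    ≡⟨ cong₂ _+_ (∑<-distrib-- n (λ m → g m * g m) (λ m → + 2 * t * g m)) (∑<-const n (t * t)) ⟩
  ∑< n (λ m → g m * g m) - ∑< n (λ m → + 2 * t * g m) + + n * (t * t)
    ≡⟨ cong (λ x → ∑< n (λ m → g m * g m) - x + + n * (t * t)) (*-distribˡ-∑< n (+ 2 * t) g) ⟨
  ∑< n (λ m → g m * g m) - + 2 * t * ∑< n g + + n * (t * t) ∎
  where
  open ≡-Reasoning
  square : ∀ x t → (x - t) * (x - t) ≡ (x * x - + 2 * t * x) + t * t
  square = ℤSolver.solve-∀

square≡1-mod-prime : ∀ {p c s} → Prime p → + p * c ≡ s * s - 1ℤ →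
                     ∃₂ λ ε t → ε * ε ≡ 1ℤ × s ≡ ε + t * + p
square≡1-mod-prime {p} {c} {s} pp pc≡s²-1 with euclidsLemmaℤ pp (s - 1ℤ) (s + 1ℤ) p∣s²-1
  where
  factor : ∀ s → (s - 1ℤ) * (s + 1ℤ) ≡ s * s - 1ℤ
  factor = ℤSolver.solve-∀
  p∣s²-1 : + p ∣ (s - 1ℤ) * (s + 1ℤ)
  p∣s²-1 = divides c (trans (factor s) (trans (sym pc≡s²-1) (ℤP.*-comm (+ p) c)))
... | inj₁ (divides t s-1≡tp) = 1ℤ , t , refl , trans (split s) (cong (_+_ 1ℤ) s-1≡tp)
  where
  split : ∀ s → s ≡ 1ℤ + (s - 1ℤ)
  split = ℤSolver.solve-∀
... | inj₂ (divides t s+1≡tp) = -1ℤ , t , refl , trans (split s) (cong (_+_ -1ℤ) s+1≡tp)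
  where
  split : ∀ s → s ≡ -1ℤ + (s + 1ℤ)
  split = ℤSolver.solve-∀

shifted-norm≡1 : ∀ p {c s t ε Q} .{{_ : ℕ.NonZero p}} → ε * ε ≡ 1ℤ → s ≡ ε + t * + p →
                 + p * c ≡ s * s - 1ℤ → Q ≡ 1ℤ + c → Q - + 2 * t * s + + p * (t * t) ≡ 1ℤ
shifted-norm≡1 p {c} {s} {t} {ε} ε²≡1 refl pc≡s²-1 refl = begin
  1ℤ + c - + 2 * t * s + + p * (t * t)
    ≡⟨ cong (λ x → 1ℤ + x - + 2 * t * s + + p * (t * t)) c≡ ⟩
  1ℤ + (+ 2 * ε * t + t * t * + p) - + 2 * t * s + + p * (t * t)
    ≡⟨ collapse ε t (+ p) ⟩
  1ℤ ∎
  where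
  open ≡-Reasoning
  expand : ∀ ε t p → (ε + t * p) * (ε + t * p) - 1ℤ ≡ p * (+ 2 * ε * t + t * t * p) + (ε * ε - 1ℤ)
  expand = ℤSolver.solve-∀
  collapse : ∀ ε t p → 1ℤ + (+ 2 * ε * t + t * t * p) - + 2 * t * (ε + t * p) + p * (t * t) ≡ 1ℤ
  collapse = ℤSolver.solve-∀
  c≡ : c ≡ + 2 * ε * t + t * t * + p
  c≡ = ℤP.*-cancelˡ-≡ (+ p) c _ (begin
    + p * c                                          ≡⟨ pc≡s²-1 ⟩
    s * s - 1ℤ                                       ≡⟨ expand ε t (+ p) ⟩
    + p * (+ 2 * ε * t + t * t * + p) + (ε * ε - 1ℤ)
      ≡⟨ cong (λ x → + p * (+ 2 * ε * t + t * t * + p) + (x - 1ℤ)) ε²≡1 ⟩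
    + p * (+ 2 * ε * t + t * t * + p) + 0ℤ           ≡⟨ ℤP.+-identityʳ _ ⟩
    + p * (+ 2 * ε * t + t * t * + p)                ∎)

∑<-01 : ∀ n {f} → (∀ m → m ℕ.< n → f m ≡ 0ℤ ⊎ f m ≡ 1ℤ) →
        ∃ λ c → ∑< n f ≡ + c × c ℕ.≤ n × (c ≡ 0 → ∀ m → m ℕ.< n → f m ≡ 0ℤ)
∑<-01 zero    f01 = 0 , refl , z≤n , λ _ _ ()
∑<-01 (suc n) {f} f01 = extend (f01 0 (s≤s z≤n)) (∑<-01 n (λ m m<n → f01 (suc m) (s≤s m<n)))
  where
  extend : f 0 ≡ 0ℤ ⊎ f 0 ≡ 1ℤ →
           ∃ (λ c → ∑< n (f ∘ suc) ≡ + c × c ℕ.≤ n × (c ≡ 0 → ∀ m → m ℕ.< n → f (suc m) ≡ 0ℤ)) →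
           ∃ (λ c → ∑< (suc n) f ≡ + c × c ℕ.≤ suc n × (c ≡ 0 → ∀ m → m ℕ.< suc n → f m ≡ 0ℤ))
  extend (inj₁ f0≡0) (c , ∑≡c , c≤n , vanish) =
    c , trans (cong₂ _+_ f0≡0 ∑≡c) (ℤP.+-identityˡ (+ c)) , ℕP.m≤n⇒m≤1+n c≤n ,
    λ { c≡0 zero _ → f0≡0 ; c≡0 (suc m) (s≤s m<n) → vanish c≡0 m m<n }
  extend (inj₂ f0≡1) (c , ∑≡c , c≤n , _) = suc c , cong₂ _+_ f0≡1 ∑≡c , s≤s c≤n , λ ()

binary-sum-∣ : ∀ n {f} → (∀ m → m ℕ.< n → f m ≡ 0ℤ ⊎ f m ≡ 1ℤ) → + suc n ∣ ∑< n f →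
               ∀ m → m ℕ.< n → f m ≡ 0ℤ
binary-sum-∣ n f01 n+1∣∑ with ∑<-01 n f01
... | c , ∑≡c , c≤n , vanish = vanish (ℤP.+-injective (∣∧∣x∣<⇒x≡0 (subst (_ ∣_) ∑≡c n+1∣∑) (s≤s c≤n)))

sum-squares≡0 : ∀ {n} (a : Fin n → ℕ) → ℕΣ.sum (λ i → a i ℕ.* a i) ≡ 0 → ∀ i → a i ≡ 0
sum-squares≡0 a ∑≡0 Fin.zero    = reduce (ℕP.m*n≡0⇒m≡0∨n≡0 (a Fin.zero) (ℕP.m+n≡0⇒m≡0 _ ∑≡0))
sum-squares≡0 a ∑≡0 (Fin.suc i) = sum-squares≡0 (a ∘ Fin.suc) (ℕP.m+n≡0⇒n≡0 (a Fin.zero ℕ.* a Fin.zero) ∑≡0) i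

sum-squares≡1 : ∀ {n} (a : Fin n → ℕ) → ℕΣ.sum (λ i → a i ℕ.* a i) ≡ 1 →
                ∃ λ j → a j ≡ 1 × ∀ i → i ≢ j → a i ≡ 0
sum-squares≡1 {zero}  a ()
sum-squares≡1 {suc n} a ∑≡1 with a Fin.zero in a₀≡
... | zero =
  let j , aj≡1 , others = sum-squares≡1 (a ∘ Fin.suc) ∑≡1
  in Fin.suc j , aj≡1 , λ { Fin.zero _ → a₀≡ ; (Fin.suc i) i≢j → others i (i≢j ∘ cong Fin.suc) }
... | suc z =
  Fin.zero , trans a₀≡ (cong suc z≡0) ,
  λ { Fin.zero i≢0 → ⊥-elim (i≢0 refl) ; (Fin.suc i) _ → sum-squares≡0 (a ∘ Fin.suc) rest≡0 i }
  where
  rest = ℕΣ.sum (λ i → a (Fin.suc i) ℕ.* a (Fin.suc i))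
  z≡0 : z ≡ 0
  z≡0 = ℕP.m+n≡0⇒m≡0 z (ℕP.m+n≡0⇒m≡0 (z ℕ.+ z ℕ.* suc z) (ℕP.suc-injective ∑≡1))
  rest≡0 : rest ≡ 0
  rest≡0 = ℕP.m+n≡0⇒n≡0 (z ℕ.+ z ℕ.* suc z) (ℕP.suc-injective ∑≡1)

sum-pos : ∀ {n} (a : Fin n → ℕ) → sum (λ i → + a i) ≡ + ℕΣ.sum a
sum-pos {zero}  a = refl
sum-pos {suc n} a = cong (_+_ (+ a Fin.zero)) (sum-pos (a ∘ Fin.suc))

i*i≡+∣i∣*∣i∣ : ∀ i → i * i ≡ + (ℤ.∣ i ∣ ℕ.* ℤ.∣ i ∣)
i*i≡+∣i∣*∣i∣ (+ n)    = sym (ℤP.pos-* n n)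
i*i≡+∣i∣*∣i∣ -[1+ n ] = refl

∣i∣≡1⇒i≡±1 : ∀ i → ℤ.∣ i ∣ ≡ 1 → i ≡ 1ℤ ⊎ i ≡ -1ℤ
∣i∣≡1⇒i≡±1 (+ n)    ∣i∣≡1 = inj₁ (cong +_ ∣i∣≡1)
∣i∣≡1⇒i≡±1 -[1+ n ] ∣i∣≡1 = inj₂ (cong -[1+_] (ℕP.suc-injective ∣i∣≡1))

sum-squares≡1ℤ : ∀ {n} (x : Fin n → ℤ) → sum (λ i → x i * x i) ≡ 1ℤ →
                 ∃ λ j → (x j ≡ 1ℤ ⊎ x j ≡ -1ℤ) × ∀ i → i ≢ j → x i ≡ 0ℤ
sum-squares≡1ℤ {n} x ∑≡1 =
  let j , ∣xj∣≡1 , others = sum-squares≡1 ∣x∣ ∑∣x∣²≡1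
  in j , ∣i∣≡1⇒i≡±1 (x j) ∣xj∣≡1 , λ i i≢j → ℤP.∣i∣≡0⇒i≡0 (others i i≢j)
  where
  ∣x∣ : Fin n → ℕ
  ∣x∣ i = ℤ.∣ x i ∣
  ∑∣x∣²≡1 : ℕΣ.sum (λ i → ∣x∣ i ℕ.* ∣x∣ i) ≡ 1
  ∑∣x∣²≡1 = ℤP.+-injective (begin
    + ℕΣ.sum (λ i → ∣x∣ i ℕ.* ∣x∣ i)   ≡⟨ sum-pos (λ i → ∣x∣ i ℕ.* ∣x∣ i) ⟨
    sum (λ i → + (∣x∣ i ℕ.* ∣x∣ i))    ≡⟨ sum-cong-≗ {n} (i*i≡+∣i∣*∣i∣ ∘ x) ⟨
    sum (λ i → x i * x i)              ≡⟨ ∑≡1 ⟩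
    1ℤ                                 ∎)
    where open ≡-Reasoning

-- Functions ℕ → ℤ of period N = suc M; M ≡ -1 (mod N) lets every index be written without subtraction.
module Cyclic (M : ℕ) where

  N : ℕ
  N = suc M

  record Periodic (f : ℕ → ℤ) : Set where
    constructor periodic
    field period : ∀ x t → f (x ℕ.+ t ℕ.* N) ≡ f x
  open Periodic public

  periodic-cong : ∀ {f} → Periodic f → ∀ {x y} s t → x ℕ.+ s ℕ.* N ≡ y ℕ.+ t ℕ.* N → f x ≡ f y
  periodic-cong {f} f-per {x} {y} s t eq =
    trans (sym (period f-per x s)) (trans (cong f eq) (period f-per y t))

  periodic-* : ∀ {f g} → Periodic f → Periodic g → Periodic (λ m → f m * g m)
  periodic-* f-per g-per = periodic λ x t → cong₂ _*_ (period f-per x t) (period g-per x t)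

  periodic-- : ∀ {f g} → Periodic f → Periodic g → Periodic (λ m → f m - g m)
  periodic-- f-per g-per = periodic λ x t → cong₂ _-_ (period f-per x t) (period g-per x t)

  periodic-affine : ∀ {f} → Periodic f → ∀ a b → Periodic (λ m → f (a ℕ.+ b ℕ.* m))
  periodic-affine f-per a b = periodic λ x t → periodic-cong f-per 0 (b ℕ.* t) (eq a b x t N)
    where
    eq : ∀ a b x t N → a ℕ.+ b ℕ.* (x ℕ.+ t ℕ.* N) ℕ.+ 0 ℕ.* N ≡ a ℕ.+ b ℕ.* x ℕ.+ b ℕ.* t ℕ.* N
    eq = ℕSolver.solve-∀

  periodic-shift : ∀ {f} → Periodic f → ∀ c → Periodic (λ m → f (m ℕ.+ c))
  periodic-shift f-per c = periodic λ x t → periodic-cong f-per 0 t (eq c x t N)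
    where
    eq : ∀ c x t N → x ℕ.+ t ℕ.* N ℕ.+ c ℕ.+ 0 ℕ.* N ≡ x ℕ.+ c ℕ.+ t ℕ.* N
    eq = ℕSolver.solve-∀

  periodic-Δ^ : ∀ {f} → Periodic f → ∀ j → Periodic (Δ^ j f)
  periodic-Δ^ f-per zero    = f-per
  periodic-Δ^ f-per (suc j) = periodic λ x t →
    cong₂ _-_ (period (periodic-Δ^ f-per j) (suc x) t) (period (periodic-Δ^ f-per j) x t)

  ∑-rotate : ∀ {f} → Periodic f → ∑< N (f ∘ suc) ≡ ∑< N f
  ∑-rotate {f} f-per = +-cancelʳ (f 0) _ _ (begin
    ∑< N (f ∘ suc) + f 0  ≡⟨ ℤP.+-comm _ (f 0) ⟩
    ∑< (suc N) f          ≡⟨ ∑<-init-last N f ⟩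
    ∑< N f + f N          ≡⟨ cong (_+_ (∑< N f)) (periodic-cong f-per 0 1 refl) ⟩
    ∑< N f + f 0          ∎)
    where open ≡-Reasoning

  ∑-shift : ∀ {f} → Periodic f → ∀ c → ∑< N (λ m → f (m ℕ.+ c)) ≡ ∑< N f
  ∑-shift {f} f-per zero    = ∑<-cong-≗ N (λ m → cong f (ℕP.+-identityʳ m))
  ∑-shift {f} f-per (suc c) = begin
    ∑< N (λ m → f (m ℕ.+ suc c))    ≡⟨ ∑<-cong-≗ N (λ m → cong f (ℕP.+-suc m c)) ⟩
    ∑< N (λ m → f (suc m ℕ.+ c))    ≡⟨ ∑-rotate (periodic-shift f-per c) ⟩
    ∑< N (λ m → f (m ℕ.+ c))        ≡⟨ ∑-shift f-per c ⟩
    ∑< N f                          ∎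
    where open ≡-Reasoning

  ∑-reflect : ∀ {f} → Periodic f → ∑< N (λ m → f (M ℕ.* m)) ≡ ∑< N f
  ∑-reflect {f} f-per = begin
    ∑< N (λ m → f (M ℕ.* m))         ≡⟨ ∑<-cong N (λ m m<N → periodic-cong f-per m 1 (reflection m m<N)) ⟨
    ∑< N (λ m → f (N ∸ suc m ℕ.+ 1))  ≡⟨ ∑<-reverse N (λ m → f (m ℕ.+ 1)) ⟨
    ∑< N (λ m → f (m ℕ.+ 1))         ≡⟨ ∑-shift f-per 1 ⟩
    ∑< N f                           ∎
    where
    open ≡-Reasoning
    eq : ∀ r m → r ℕ.+ 1 ℕ.+ m ℕ.* suc (r ℕ.+ m) ≡ (r ℕ.+ m) ℕ.* m ℕ.+ 1 ℕ.* suc (r ℕ.+ m)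
    eq = ℕSolver.solve-∀
    -- Writing M as (M ∸ m) + m turns this into the semiring identity eq.
    reflection : ∀ m → m ℕ.< N → N ∸ suc m ℕ.+ 1 ℕ.+ m ℕ.* N ≡ M ℕ.* m ℕ.+ 1 ℕ.* N
    reflection m (s≤s m≤M) = subst (λ n → M ∸ m ℕ.+ 1 ℕ.+ m ℕ.* suc n ≡ n ℕ.* m ℕ.+ 1 ℕ.* suc n)
                               (ℕP.m∸n+n≡m m≤M) (eq (M ∸ m) m)

  ∑-reflect-shift : ∀ {f} → Periodic f → ∀ k → ∑< N (λ m → f (k ℕ.+ M ℕ.* m)) ≡ ∑< N f
  ∑-reflect-shift {f} f-per k = begin
    ∑< N (λ m → f (k ℕ.+ M ℕ.* m))         ≡⟨ ∑<-cong-≗ N (λ m → periodic-cong f-per k (M ℕ.* k) (eq M m k)) ⟨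
    ∑< N (λ m → f (M ℕ.* (m ℕ.+ M ℕ.* k)))  ≡⟨ ∑-shift (periodic-affine f-per 0 M) (M ℕ.* k) ⟩
    ∑< N (λ m → f (M ℕ.* m))               ≡⟨ ∑-reflect f-per ⟩
    ∑< N f                                 ∎
    where
    open ≡-Reasoning
    eq : ∀ M m k → M ℕ.* (m ℕ.+ M ℕ.* k) ℕ.+ k ℕ.* suc M ≡ k ℕ.+ M ℕ.* m ℕ.+ M ℕ.* k ℕ.* suc M
    eq = ℕSolver.solve-∀

  infixl 7 _⊛_

  _⊛_ : (ℕ → ℤ) → (ℕ → ℤ) → ℕ → ℤ
  (f ⊛ g) k = ∑< N (λ m → f m * g (k ℕ.+ M ℕ.* m))

  reflect : (ℕ → ℤ) → ℕ → ℤ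
  reflect f k = f (M ℕ.* k)

  periodic-⊛ : ∀ f {g} → Periodic g → Periodic (f ⊛ g)
  periodic-⊛ f g-per = periodic λ x t →
    ∑<-cong-≗ N (λ m → cong (f m *_) (periodic-cong g-per 0 t (eq x t N M m)))
    where
    eq : ∀ x t N M m → x ℕ.+ t ℕ.* N ℕ.+ M ℕ.* m ℕ.+ 0 ℕ.* N ≡ x ℕ.+ M ℕ.* m ℕ.+ t ℕ.* N
    eq = ℕSolver.solve-∀

  periodic-reflect : ∀ {f} → Periodic f → Periodic (reflect f)
  periodic-reflect f-per = periodic-affine f-per 0 M

  ⊛-cong : ∀ {f f′ g g′} → f ≗ f′ → g ≗ g′ → f ⊛ g ≗ f′ ⊛ g′
  ⊛-cong f≗f′ g≗g′ k = ∑<-cong-≗ N (λ m → cong₂ _*_ (f≗f′ m) (g≗g′ (k ℕ.+ M ℕ.* m)))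

  ⊛-comm : ∀ {f g} → Periodic f → Periodic g → f ⊛ g ≗ g ⊛ f
  ⊛-comm {f} {g} f-per g-per k = begin
    ∑< N (λ m → f m * g (k ℕ.+ M ℕ.* m))
      ≡⟨ ∑-reflect-shift (periodic-* f-per (periodic-affine g-per k M)) k ⟨
    ∑< N (λ m → f (k ℕ.+ M ℕ.* m) * g (k ℕ.+ M ℕ.* (k ℕ.+ M ℕ.* m)))
      ≡⟨ ∑<-cong-≗ N (λ m → trans (ℤP.*-comm (f (k ℕ.+ M ℕ.* m)) (g (k ℕ.+ M ℕ.* (k ℕ.+ M ℕ.* m))))
                                  (cong (_* f (k ℕ.+ M ℕ.* m))
                                        (periodic-cong g-per m (k ℕ.+ M ℕ.* m) (eq k M m)))) ⟩
    ∑< N (λ m → g m * f (k ℕ.+ M ℕ.* m)) ∎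
    where
    open ≡-Reasoning
    eq : ∀ k M m → k ℕ.+ M ℕ.* (k ℕ.+ M ℕ.* m) ℕ.+ m ℕ.* suc M ≡ m ℕ.+ (k ℕ.+ M ℕ.* m) ℕ.* suc M
    eq = ℕSolver.solve-∀

  ⊛-assoc : ∀ {f g h} → Periodic g → Periodic h → (f ⊛ g) ⊛ h ≗ f ⊛ (g ⊛ h)
  ⊛-assoc {f} {g} {h} g-per h-per k = begin
    ∑< N (λ m → ∑< N (λ j → f j * g (m ℕ.+ M ℕ.* j)) * h (k ℕ.+ M ℕ.* m))
      ≡⟨ ∑<-cong-≗ N (λ m → *-distribʳ-∑< N (h (k ℕ.+ M ℕ.* m)) (λ j → f j * g (m ℕ.+ M ℕ.* j))) ⟩
    ∑< N (λ m → ∑< N (λ j → f j * g (m ℕ.+ M ℕ.* j) * h (k ℕ.+ M ℕ.* m)))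
      ≡⟨ ∑<-comm N N (λ m j → f j * g (m ℕ.+ M ℕ.* j) * h (k ℕ.+ M ℕ.* m)) ⟩
    ∑< N (λ j → ∑< N (λ m → f j * g (m ℕ.+ M ℕ.* j) * h (k ℕ.+ M ℕ.* m)))
      ≡⟨ ∑<-cong-≗ N (λ j → trans (∑<-cong-≗ N (λ m → ℤP.*-assoc (f j) (g (m ℕ.+ M ℕ.* j)) (h (k ℕ.+ M ℕ.* m))))
                                  (sym (*-distribˡ-∑< N (f j) (λ m → g (m ℕ.+ M ℕ.* j) * h (k ℕ.+ M ℕ.* m))))) ⟩
    ∑< N (λ j → f j * ∑< N (λ m → g (m ℕ.+ M ℕ.* j) * h (k ℕ.+ M ℕ.* m)))
      ≡⟨ ∑<-cong-≗ N (λ j → cong (f j *_) (inner j)) ⟩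
    ∑< N (λ j → f j * (g ⊛ h) (k ℕ.+ M ℕ.* j)) ∎
    where
    open ≡-Reasoning
    eq₁ : ∀ m j M → m ℕ.+ j ℕ.+ M ℕ.* j ℕ.+ 0 ℕ.* suc M ≡ m ℕ.+ j ℕ.* suc M
    eq₁ = ℕSolver.solve-∀
    eq₂ : ∀ k m j M → k ℕ.+ M ℕ.* (m ℕ.+ j) ≡ k ℕ.+ M ℕ.* j ℕ.+ M ℕ.* m
    eq₂ = ℕSolver.solve-∀
    inner : ∀ j → ∑< N (λ m → g (m ℕ.+ M ℕ.* j) * h (k ℕ.+ M ℕ.* m)) ≡ (g ⊛ h) (k ℕ.+ M ℕ.* j)
    inner j = begin
      ∑< N (λ m → g (m ℕ.+ M ℕ.* j) * h (k ℕ.+ M ℕ.* m))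
        ≡⟨ ∑-shift (periodic-* (periodic-shift g-per (M ℕ.* j)) (periodic-affine h-per k M)) j ⟨
      ∑< N (λ m → g (m ℕ.+ j ℕ.+ M ℕ.* j) * h (k ℕ.+ M ℕ.* (m ℕ.+ j)))
        ≡⟨ ∑<-cong-≗ N (λ m → cong₂ _*_ (periodic-cong g-per 0 j (eq₁ m j M)) (cong h (eq₂ k m j M))) ⟩
      (g ⊛ h) (k ℕ.+ M ℕ.* j) ∎

  reflect-⊛ : ∀ {f g} → Periodic f → Periodic g → reflect (f ⊛ g) ≗ reflect f ⊛ reflect g
  reflect-⊛ {f} {g} f-per g-per k = begin
    ∑< N (λ m → f m * g (M ℕ.* k ℕ.+ M ℕ.* m))
      ≡⟨ ∑-reflect (periodic-* f-per (periodic-affine g-per (M ℕ.* k) M)) ⟨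
    ∑< N (λ m → f (M ℕ.* m) * g (M ℕ.* k ℕ.+ M ℕ.* (M ℕ.* m)))
      ≡⟨ ∑<-cong-≗ N (λ m → cong (λ x → f (M ℕ.* m) * g x) (eq M k m)) ⟩
    ∑< N (λ m → f (M ℕ.* m) * g (M ℕ.* (k ℕ.+ M ℕ.* m))) ∎
    where
    open ≡-Reasoning
    eq : ∀ M k m → M ℕ.* k ℕ.+ M ℕ.* (M ℕ.* m) ≡ M ℕ.* (k ℕ.+ M ℕ.* m)
    eq = ℕSolver.solve-∀

  ∑-⊛ : ∀ f {g} → Periodic g → ∑< N (f ⊛ g) ≡ ∑< N f * ∑< N g
  ∑-⊛ f {g} g-per = begin
    ∑< N (λ k → ∑< N (λ m → f m * g (k ℕ.+ M ℕ.* m)))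
      ≡⟨ ∑<-comm N N (λ k m → f m * g (k ℕ.+ M ℕ.* m)) ⟩
    ∑< N (λ m → ∑< N (λ k → f m * g (k ℕ.+ M ℕ.* m)))
      ≡⟨ ∑<-cong-≗ N (λ m → sym (*-distribˡ-∑< N (f m) (λ k → g (k ℕ.+ M ℕ.* m)))) ⟩
    ∑< N (λ m → f m * ∑< N (λ k → g (k ℕ.+ M ℕ.* m)))
      ≡⟨ ∑<-cong-≗ N (λ m → cong (f m *_) (∑-shift g-per (M ℕ.* m))) ⟩
    ∑< N (λ m → f m * ∑< N g)
      ≡⟨ *-distribʳ-∑< N (∑< N g) f ⟨
    ∑< N f * ∑< N g ∎
    where open ≡-Reasoning

  ⊛-interchange : ∀ {f g h l} → Periodic g → Periodic h → Periodic l →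
                  (f ⊛ g) ⊛ (h ⊛ l) ≗ (f ⊛ h) ⊛ (g ⊛ l)
  ⊛-interchange {f} {g} {h} {l} g-per h-per l-per k = begin
    ((f ⊛ g) ⊛ (h ⊛ l)) k  ≡⟨ ⊛-assoc {f} g-per (periodic-⊛ h l-per) k ⟩
    (f ⊛ (g ⊛ (h ⊛ l))) k  ≡⟨ ⊛-cong {f} (λ _ → refl) middle k ⟩
    (f ⊛ (h ⊛ (g ⊛ l))) k  ≡⟨ ⊛-assoc {f} h-per (periodic-⊛ g l-per) k ⟨
    ((f ⊛ h) ⊛ (g ⊛ l)) k  ∎
    where
    open ≡-Reasoning
    middle : g ⊛ (h ⊛ l) ≗ h ⊛ (g ⊛ l)
    middle m = begin
      (g ⊛ (h ⊛ l)) m  ≡⟨ ⊛-assoc {g} h-per l-per m ⟨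
      ((g ⊛ h) ⊛ l) m  ≡⟨ ⊛-cong {g = l} (⊛-comm g-per h-per) (λ _ → refl) m ⟩
      ((h ⊛ g) ⊛ l) m  ≡⟨ ⊛-assoc {h} g-per l-per m ⟩
      (h ⊛ (g ⊛ l)) m  ∎

  ⊛-distrib-- : ∀ f g h → f ⊛ (λ m → g m - h m) ≗ λ k → (f ⊛ g) k - (f ⊛ h) k
  ⊛-distrib-- f g h k = begin
    ∑< N (λ m → f m * (g (k ℕ.+ M ℕ.* m) - h (k ℕ.+ M ℕ.* m)))
      ≡⟨ ∑<-cong-≗ N (λ m → x[y-z]≈xy-xz (f m) (g (k ℕ.+ M ℕ.* m)) (h (k ℕ.+ M ℕ.* m))) ⟩
    ∑< N (λ m → f m * g (k ℕ.+ M ℕ.* m) - f m * h (k ℕ.+ M ℕ.* m))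
      ≡⟨ ∑<-distrib-- N (λ m → f m * g (k ℕ.+ M ℕ.* m)) (λ m → f m * h (k ℕ.+ M ℕ.* m)) ⟩
    (f ⊛ g) k - (f ⊛ h) k ∎
    where open ≡-Reasoning

  ⊛-Δ^ : ∀ f g j → f ⊛ Δ^ j g ≗ Δ^ j (f ⊛ g)
  ⊛-Δ^ f g zero    k = refl
  ⊛-Δ^ f g (suc j) k = trans (⊛-distrib-- f (Δ^ j g ∘ suc) (Δ^ j g) k)
                               (cong₂ _-_ (⊛-Δ^ f g j (suc k)) (⊛-Δ^ f g j k))

  ∣-⊛-∑*const : ∀ {d f} A c → (∀ k → d ∣ f k - c) → ∀ k → d ∣ (A ⊛ f) k - ∑< N A * c
  ∣-⊛-∑*const {d} {f} A c d∣f-c k = subst (d ∣_) expand (∣-∑< N (λ m _ → ∣n⇒∣m*n (A m) (d∣f-c (k ℕ.+ M ℕ.* m))))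
    where
    open ≡-Reasoning
    expand : ∑< N (λ m → A m * (f (k ℕ.+ M ℕ.* m) - c)) ≡ (A ⊛ f) k - ∑< N A * c
    expand = begin
      ∑< N (λ m → A m * (f (k ℕ.+ M ℕ.* m) - c))
        ≡⟨ ∑<-cong-≗ N (λ m → x[y-z]≈xy-xz (A m) (f (k ℕ.+ M ℕ.* m)) c) ⟩
      ∑< N (λ m → A m * f (k ℕ.+ M ℕ.* m) - A m * c)
        ≡⟨ ∑<-distrib-- N (λ m → A m * f (k ℕ.+ M ℕ.* m)) (λ m → A m * c) ⟩
      (A ⊛ f) k - ∑< N (λ m → A m * c)
        ≡⟨ cong (_-_ ((A ⊛ f) k)) (*-distribʳ-∑< N c A) ⟨
      (A ⊛ f) k - ∑< N A * c ∎

  module _ (N-prime : Prime N) (N-odd : N % 2 ≡ 1) where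

    1<N : 1 ℕ.< N
    1<N = ℕ.nonTrivial⇒n>1 N {{prime⇒nonTrivial N-prime}}

    -1^N≡-1 : -1ℤ ^ N ≡ -1ℤ
    -1^N≡-1 = trans (cong (-1ℤ ^_) (trans (m≡m%n+[m/n]*n N 2) (cong (ℕ._+ (N ℕ./ 2) ℕ.* 2) N-odd)))
                    (-1^odd (N ℕ./ 2))
      where
      -1^odd : ∀ q → -1ℤ ^ suc (q ℕ.* 2) ≡ -1ℤ
      -1^odd zero    = refl
      -1^odd (suc q) = cong (λ x → -1ℤ * (-1ℤ * x)) (-1^odd q)

    -- (T - 1)^N ≡ T^N - 1 = 0 (mod N) for the shift T, which has order N on periodic functions.
    ∣-Δ^N : ∀ {f} → Periodic f → ∀ k → + N ∣ Δ^ N f k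
    ∣-Δ^N {f} f-per k = subst (+ N ∣_) (sym (Δ^≡signedBinomialSum N f k))
                          (∣n⇒∣m*n (-1ℤ ^ N) (subst (+ N ∣_) (sym endsCancel) N∣middle))
      where
      open ≡-Reasoning
      t : ℕ → ℤ
      t i = -1ℤ ^ i * (+ (N C i) * f (k ℕ.+ i))
      middle = ∑< M (λ i → t (suc i))
      N∣middle : + N ∣ middle
      N∣middle = ∣-∑< M {t ∘ suc} (λ i i<M → ∣n⇒∣m*n (-1ℤ ^ suc i) (∣m⇒∣m*n (f (k ℕ.+ suc i))
                   (∣ᵤ⇒∣ {+ N} {+ (N C suc i)} (p∣pCk N-prime (suc i) (s≤s z≤n) (s≤s i<M)))))
      last : t N ≡ -1ℤ * (1ℤ * f (k ℕ.+ 0))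
      last rewrite -1^N≡-1 | nCn≡1 N = cong (λ x → -1ℤ * (1ℤ * x)) (periodic-cong f-per 0 1 (eq k N))
        where
        eq : ∀ k N → k ℕ.+ N ℕ.+ 0 ℕ.* N ≡ k ℕ.+ 0 ℕ.+ 1 ℕ.* N
        eq = ℕSolver.solve-∀
      cancel : ∀ a m → 1ℤ * (1ℤ * a) + (m + -1ℤ * (1ℤ * a)) ≡ m
      cancel = ℤSolver.solve-∀
      endsCancel : signedBinomialSum N f k ≡ middle
      endsCancel = begin
        t 0 + ∑< N (t ∘ suc)                             ≡⟨ cong (_+_ (t 0)) (∑<-init-last M (t ∘ suc)) ⟩
        t 0 + (middle + t N)                             ≡⟨ cong (λ x → t 0 + (middle + x)) last ⟩
        t 0 + (middle + -1ℤ * (1ℤ * f (k ℕ.+ 0)))        ≡⟨ cancel (f (k ℕ.+ 0)) middle ⟩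
        middle                                           ∎

    module _ {A} (N∤∑A : ¬ (+ N ∣ ∑< N A)) where

      -- Downward induction on j, starting from N ∣ Δ^N e: if N ∣ Δ^(j+1) e, then Δ^j e is constant
      -- mod N, so N ∣ (A ⊛ Δ^j e)(0) ≡ A(1) · Δ^j e(0) and N ∤ A(1) gives N ∣ Δ^j e.
      ⊛-unit-mod : ∀ {e} → Periodic e → (∀ k → + N ∣ (A ⊛ e) k) → ∀ k → + N ∣ e k
      ⊛-unit-mod {e} e-per N∣A⊛e = descend N 0 (subst P (sym (ℕP.+-identityʳ N)) (∣-Δ^N e-per))
        where
        P : ℕ → Set
        P j = ∀ k → + N ∣ Δ^ j e k
        lower : ∀ j → P (suc j) → P j
        lower j N∣Δf k = subst (+ N ∣_) (restore (f k) (f 0)) (∣m∣n⇒∣m+n (f≡f0 k) N∣f0)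
          where
          f = Δ^ j e
          f≡f0 : ∀ k → + N ∣ f k - f 0
          f≡f0 = ∣-Δ⇒∣-telescope {f = f} N∣Δf
          N∣A⊛f : + N ∣ (A ⊛ f) 0
          N∣A⊛f = subst (+ N ∣_) (sym (⊛-Δ^ A e j 0)) (∣-Δ^ N∣A⊛e j 0)
          recover : ∀ x y → x - (x - y) ≡ y
          recover = ℤSolver.solve-∀
          restore : ∀ x y → (x - y) + y ≡ x
          restore = ℤSolver.solve-∀
          N∣∑A*f0 : + N ∣ ∑< N A * f 0
          N∣∑A*f0 = subst (+ N ∣_) (recover ((A ⊛ f) 0) (∑< N A * f 0))
                      (∣m∣n⇒∣m-n N∣A⊛f (∣-⊛-∑*const {f = f} A (f 0) f≡f0 0))
          N∣f0 : + N ∣ f 0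
          N∣f0 = fromInj₂ (⊥-elim ∘ N∤∑A) (euclidsLemmaℤ N-prime (∑< N A) (f 0) N∣∑A*f0)
        descend : ∀ r j → P (r ℕ.+ j) → P j
        descend zero    j h = h
        descend (suc r) j h = descend r j (lower (r ℕ.+ j) h)

      -- By ⊛-unit-mod, e = q N with A ⊛ q = 0 again, and |q k| < |e k| unless e k = 0.
      ⊛-cancel≤ : ∀ r {e} → Periodic e → (∀ k → (A ⊛ e) k ≡ 0ℤ) → ∀ k → ℤ.∣ e k ∣ ℕ.≤ r → e k ≡ 0ℤ
      ⊛-cancel≤ zero    _     _     k ∣ek∣≤0 = ℤP.∣i∣≡0⇒i≡0 (ℕP.n≤0⇒n≡0 ∣ek∣≤0)
      ⊛-cancel≤ (suc r) {e} e-per A⊛e≡0 k ∣ek∣≤1+r =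
        trans (e≡qN k) (trans (cong (_* + N) (⊛-cancel≤ r q-per A⊛q≡0 k ∣qk∣≤r)) (ℤP.*-zeroˡ (+ N)))
        where
        N∣e : ∀ k → + N ∣ e k
        N∣e = ⊛-unit-mod e-per (λ k → divides 0ℤ (A⊛e≡0 k))
        q : ℕ → ℤ
        q k = _∣_.quotient (N∣e k)
        e≡qN : ∀ k → e k ≡ q k * + N
        e≡qN k = _∣_.equality (N∣e k)
        q-per : Periodic q
        q-per = periodic λ x t → ℤP.*-cancelʳ-≡ _ _ (+ N)
                  (trans (sym (e≡qN (x ℕ.+ t ℕ.* N))) (trans (period e-per x t) (e≡qN x)))
        A⊛q≡0 : ∀ k → (A ⊛ q) k ≡ 0ℤ
        A⊛q≡0 k = ℤP.*-cancelʳ-≡ _ _ (+ N) (begin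
          (A ⊛ q) k * + N
            ≡⟨ *-distribʳ-∑< N (+ N) (λ m → A m * q (k ℕ.+ M ℕ.* m)) ⟩
          ∑< N (λ m → A m * q (k ℕ.+ M ℕ.* m) * + N)
            ≡⟨ ∑<-cong-≗ N (λ m → ℤP.*-assoc (A m) (q (k ℕ.+ M ℕ.* m)) (+ N)) ⟩
          ∑< N (λ m → A m * (q (k ℕ.+ M ℕ.* m) * + N))
            ≡⟨ ∑<-cong-≗ N (λ m → cong (A m *_) (e≡qN (k ℕ.+ M ℕ.* m))) ⟨
          (A ⊛ e) k
            ≡⟨ A⊛e≡0 k ⟩
          0ℤ * + N ∎)
          where open ≡-Reasoning
        ∣qk∣≤r : ℤ.∣ q k ∣ ℕ.≤ r
        ∣qk∣≤r = m*n≤1+r⇒m≤r 1<N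
                   (subst (ℕ._≤ suc r) (trans (cong ℤ.∣_∣ (e≡qN k)) (ℤP.abs-* (q k) (+ N))) ∣ek∣≤1+r)

      ⊛-cancel : ∀ {e} → Periodic e → (∀ k → (A ⊛ e) k ≡ 0ℤ) → ∀ k → e k ≡ 0ℤ
      ⊛-cancel {e} e-per A⊛e≡0 k = ⊛-cancel≤ ℤ.∣ e k ∣ e-per A⊛e≡0 k ℕP.≤-refl

      ⊛-const⇒const : ∀ {d} → Periodic d → (∀ k → (A ⊛ d) k ≡ (A ⊛ d) 0) → ∀ k → d k ≡ d 0
      ⊛-const⇒const {d} d-per A⊛d-const = d-const
        where
        Δd≡0 : ∀ k → Δ d k ≡ 0ℤ
        Δd≡0 = ⊛-cancel (periodic-Δ^ d-per 1) λ k →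
          trans (⊛-Δ^ A d 1 k) (trans (cong₂ _-_ (A⊛d-const (suc k)) (A⊛d-const k)) (ℤP.+-inverseʳ ((A ⊛ d) 0)))
        d-const : ∀ k → d k ≡ d 0
        d-const zero    = refl
        d-const (suc k) = trans (ℤP.i-j≡0⇒i≡j _ _ (Δd≡0 k)) (d-const k)

module Cyclotomic (M : ℕ) where

  open Cyclic M

  coeffs : Elt N → ℕ → ℤ
  coeffs a n = a (idx N n)

  toℕ-idx : ∀ n → toℕ (idx N n) ≡ n % N
  toℕ-idx n = FinP.toℕ-fromℕ< (m%n<n n N)

  idx-toℕ : ∀ i → idx N (toℕ i) ≡ i
  idx-toℕ i = FinP.toℕ-injective (trans (toℕ-idx (toℕ i)) (m<n⇒m%n≡m (FinP.toℕ<n i)))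

  periodic-coeffs : ∀ a → Periodic (coeffs a)
  periodic-coeffs a = periodic λ x t →
    cong a (FinP.fromℕ<-cong _ _ ([m+kn]%n≡m%n x t N) (m%n<n (x ℕ.+ t ℕ.* N) N) (m%n<n x N))

  coeffs-· : ∀ a b → coeffs (_·_ N a b) ≗ coeffs a ⊛ coeffs b
  coeffs-· a b k = begin
    sumF (λ i → a i * b (idx N (toℕ (idx N k) ℕ.+ (N ∸ toℕ i))))
      ≡⟨ sumF≡∑< N _ (λ m → coeffs a m * coeffs b (toℕ (idx N k) ℕ.+ (N ∸ m)))
                      (λ i → cong (λ j → a j * b (idx N (toℕ (idx N k) ℕ.+ (N ∸ toℕ i)))) (sym (idx-toℕ i))) ⟩
    ∑< N (λ m → coeffs a m * coeffs b (toℕ (idx N k) ℕ.+ (N ∸ m)))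
      ≡⟨ ∑<-cong N (λ m m<N → cong (coeffs a m *_)
                      (periodic-cong (periodic-coeffs b) (m ℕ.+ k ℕ./ N) 1 (wrap m m<N))) ⟩
    (coeffs a ⊛ coeffs b) k ∎
    where
    open ≡-Reasoning
    eq : ∀ r Q u m → r ℕ.+ suc u ℕ.+ (m ℕ.+ Q) ℕ.* suc (u ℕ.+ m)
                   ≡ r ℕ.+ Q ℕ.* suc (u ℕ.+ m) ℕ.+ (u ℕ.+ m) ℕ.* m ℕ.+ 1 ℕ.* suc (u ℕ.+ m)
    eq = ℕSolver.solve-∀
    wrap : ∀ m → m ℕ.< N → toℕ (idx N k) ℕ.+ (N ∸ m) ℕ.+ (m ℕ.+ k ℕ./ N) ℕ.* N ≡ k ℕ.+ M ℕ.* m ℕ.+ 1 ℕ.* N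
    wrap m (s≤s m≤M) = begin
      toℕ (idx N k) ℕ.+ (N ∸ m) ℕ.+ (m ℕ.+ k ℕ./ N) ℕ.* N
        ≡⟨ cong₂ (λ x y → x ℕ.+ y ℕ.+ (m ℕ.+ k ℕ./ N) ℕ.* N) (toℕ-idx k) (ℕP.+-∸-assoc 1 m≤M) ⟩
      k % N ℕ.+ suc (M ∸ m) ℕ.+ (m ℕ.+ k ℕ./ N) ℕ.* N
        ≡⟨ subst (λ z → k % N ℕ.+ suc (M ∸ m) ℕ.+ (m ℕ.+ k ℕ./ N) ℕ.* suc z
                        ≡ k % N ℕ.+ k ℕ./ N ℕ.* suc z ℕ.+ z ℕ.* m ℕ.+ 1 ℕ.* suc z)
                 (ℕP.m∸n+n≡m m≤M) (eq (k % N) (k ℕ./ N) (M ∸ m) m) ⟩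
      k % N ℕ.+ k ℕ./ N ℕ.* N ℕ.+ M ℕ.* m ℕ.+ 1 ℕ.* N
        ≡⟨ cong (λ x → x ℕ.+ M ℕ.* m ℕ.+ 1 ℕ.* N) (m≡m%n+[m/n]*n k N) ⟨
      k ℕ.+ M ℕ.* m ℕ.+ 1 ℕ.* N ∎

  coeffs-conj : ∀ a → coeffs (conj N a) ≗ reflect (coeffs a)
  coeffs-conj a n = periodic-cong (periodic-coeffs a) (n % N ℕ.+ M ℕ.* (n ℕ./ N)) 1 wrap
    where
    open ≡-Reasoning
    eq : ∀ r Q u → suc u ℕ.+ (r ℕ.+ (u ℕ.+ r) ℕ.* Q) ℕ.* suc (u ℕ.+ r)
                 ≡ (u ℕ.+ r) ℕ.* (r ℕ.+ Q ℕ.* suc (u ℕ.+ r)) ℕ.+ 1 ℕ.* suc (u ℕ.+ r)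
    eq = ℕSolver.solve-∀
    wrap : N ∸ toℕ (idx N n) ℕ.+ (n % N ℕ.+ M ℕ.* (n ℕ./ N)) ℕ.* N ≡ M ℕ.* n ℕ.+ 1 ℕ.* N
    r≤M : n % N ℕ.≤ M
    r≤M = ℕP.≤-pred (m%n<n n N)
    wrap = begin
      N ∸ toℕ (idx N n) ℕ.+ (n % N ℕ.+ M ℕ.* (n ℕ./ N)) ℕ.* N
        ≡⟨ cong (λ x → x ℕ.+ (n % N ℕ.+ M ℕ.* (n ℕ./ N)) ℕ.* N)
                (trans (cong (N ∸_) (toℕ-idx n)) (ℕP.+-∸-assoc 1 r≤M)) ⟩
      suc (M ∸ n % N) ℕ.+ (n % N ℕ.+ M ℕ.* (n ℕ./ N)) ℕ.* N
        ≡⟨ subst (λ z → suc (M ∸ n % N) ℕ.+ (n % N ℕ.+ z ℕ.* (n ℕ./ N)) ℕ.* suc z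
                        ≡ z ℕ.* (n % N ℕ.+ n ℕ./ N ℕ.* suc z) ℕ.+ 1 ℕ.* suc z)
                 (ℕP.m∸n+n≡m r≤M) (eq (n % N) (n ℕ./ N) (M ∸ n % N)) ⟩
      M ℕ.* (n % N ℕ.+ n ℕ./ N ℕ.* N) ℕ.+ 1 ℕ.* N
        ≡⟨ cong (λ x → M ℕ.* x ℕ.+ 1 ℕ.* N) (m≡m%n+[m/n]*n n N) ⟨
      M ℕ.* n ℕ.+ 1 ℕ.* N ∎

  ζ^-at-idx : ∀ k → ζ^ N k (idx N k) ≡ 1ℤ
  ζ^-at-idx k with idx N k FinP.≟ idx N k
  ... | yes _  = refl
  ... | no k≢k = ⊥-elim (k≢k refl)

  ζ^-off-idx : ∀ k i → i ≢ idx N k → ζ^ N k i ≡ 0ℤ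
  ζ^-off-idx k i i≢k with i FinP.≟ idx N k
  ... | yes i≡k = ⊥-elim (i≢k i≡k)
  ... | no _    = refl

  coeffs-ζ^0-suc : ∀ m → m ℕ.< M → coeffs (ζ^ N 0) (suc m) ≡ 0ℤ
  coeffs-ζ^0-suc m m<M = ζ^-off-idx 0 (idx N (suc m)) λ eq →
    ℕP.1+n≢0 (trans (sym (m<n⇒m%n≡m (s≤s m<M))) (trans (sym (toℕ-idx (suc m))) (cong toℕ eq)))

  ∑-ζ^0 : ∑< N (coeffs (ζ^ N 0)) ≡ 1ℤ
  ∑-ζ^0 = cong₂ _+_ (ζ^-at-idx 0) (trans (∑<-cong M coeffs-ζ^0-suc) (∑<-zero M))

  ⊛-ζ^0 : ∀ {f} → Periodic f → f ⊛ coeffs (ζ^ N 0) ≗ f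
  ⊛-ζ^0 {f} f-per k = begin
    (f ⊛ δ) k
      ≡⟨ ⊛-comm f-per (periodic-coeffs (ζ^ N 0)) k ⟩
    δ 0 * f (k ℕ.+ M ℕ.* 0) + ∑< M (λ m → δ (suc m) * f (k ℕ.+ M ℕ.* suc m))
      ≡⟨ cong₂ _+_ (cong₂ _*_ (ζ^-at-idx 0) (cong (λ x → f (k ℕ.+ x)) (ℕP.*-zeroʳ M)))
                   (trans (∑<-cong M (λ m m<M → cong (_* f (k ℕ.+ M ℕ.* suc m)) (coeffs-ζ^0-suc m m<M)))
                          (∑<-zero M)) ⟩
    1ℤ * f (k ℕ.+ 0) + 0ℤ
      ≡⟨ trans (ℤP.+-identityʳ _) (trans (ℤP.*-identityˡ _) (cong f (ℕP.+-identityʳ k))) ⟩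
    f k ∎
    where
    open ≡-Reasoning
    δ = coeffs (ζ^ N 0)

  ≈-sym : ∀ {a b} → _≈_ N a b → _≈_ N b a
  ≈-sym a≈b i 1≤i i<N = sym (a≈b i 1≤i i<N)

  coeffs-mod : ∀ a n → coeffs a n ≡ coeffs a (n % N)
  coeffs-mod a n = cong a (FinP.fromℕ<-cong _ _ (sym (m%n%n≡m%n n N)) (m%n<n n N) (m%n<n (n % N) N))

  ≈⇒coeffs-diff-const : ∀ {a b} → _≈_ N a b → ∀ n → coeffs a n - coeffs b n ≡ coeffs a 0 - coeffs b 0
  ≈⇒coeffs-diff-const {a} {b} a≈b n =
    trans (cong₂ _-_ (coeffs-mod a n) (coeffs-mod b n)) (below (n % N) (m%n<n n N))
    where
    below : ∀ r → r ℕ.< N → coeffs a r - coeffs b r ≡ coeffs a 0 - coeffs b 0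
    below zero    _   = refl
    below (suc i) r<N = m-n≡p-q⇒m-p≡n-q {coeffs a (suc i)} {coeffs a 0} (a≈b (suc i) (s≤s z≤n) r<N)

  coeffs-diff-const⇒≈ : ∀ {a b} → (∀ n → n ℕ.< N → coeffs a n - coeffs b n ≡ coeffs a 0 - coeffs b 0) →
                        _≈_ N a b
  coeffs-diff-const⇒≈ {a} {b} diff-const i _ i<N = m-n≡p-q⇒m-p≡n-q {coeffs a i} {coeffs b i} (diff-const i i<N)

  binary⇒N∤∑ : ∀ β → IsBinary N β → ¬ (+ N ∣ ∑< N (coeffs β))
  binary⇒N∤∑ β (β≉0 , coords01) N∣∑b = β≉0 (coords-vanish coords01)
    where
    b = coeffs β
    c : ℕ → ℤ
    c m = coord N β (suc m)
    split : ∀ x y → y ≡ x + (y - x)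
    split = ℤSolver.solve-∀
    collect : ∀ x m C → x + (m * x + C) ≡ (1ℤ + m) * x + C
    collect = ℤSolver.solve-∀
    ∑b≡ : ∑< N b ≡ + N * b 0 + ∑< M c
    ∑b≡ = begin
      b 0 + ∑< M (b ∘ suc)                   ≡⟨ cong (_+_ (b 0)) (∑<-cong-≗ M (λ m → split (b 0) (b (suc m)))) ⟩
      b 0 + ∑< M (λ m → b 0 + c m)           ≡⟨ cong (_+_ (b 0)) (∑<-distrib-+ M (λ _ → b 0) c) ⟩
      b 0 + (∑< M (λ _ → b 0) + ∑< M c)      ≡⟨ cong (λ x → b 0 + (x + ∑< M c)) (∑<-const M (b 0)) ⟩
      b 0 + (+ M * b 0 + ∑< M c)             ≡⟨ collect (b 0) (+ M) (∑< M c) ⟩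
      + N * b 0 + ∑< M c                     ∎
      where open ≡-Reasoning
    N∣∑c : + N ∣ ∑< M c
    N∣∑c = ∣m+n∣m⇒∣n (subst (+ N ∣_) ∑b≡ N∣∑b) (∣m⇒∣m*n (b 0) ∣-refl)
    zero-coords⇒≈0 : (∀ m → m ℕ.< M → c m ≡ 0ℤ) → _≈_ N β (0ᴼ N)
    zero-coords⇒≈0 c≡0 (suc m) _ (s≤s m<M) = c≡0 m m<M
    flip : ∀ {x} → x ≡ -1ℤ ⊎ x ≡ 0ℤ → - x ≡ 0ℤ ⊎ - x ≡ 1ℤ
    flip (inj₁ refl) = inj₂ refl
    flip (inj₂ refl) = inj₁ refl
    coords-vanish : (∀ i → 1 ℕ.≤ i → i ℕ.< N → coord N β i ≡ 0ℤ ⊎ coord N β i ≡ 1ℤ)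
                  ⊎ (∀ i → 1 ℕ.≤ i → i ℕ.< N → coord N β i ≡ -1ℤ ⊎ coord N β i ≡ 0ℤ) → _≈_ N β (0ᴼ N)
    coords-vanish (inj₁ c01) = zero-coords⇒≈0
      (binary-sum-∣ M (λ m m<M → c01 (suc m) (s≤s z≤n) (s≤s m<M)) N∣∑c)
    coords-vanish (inj₂ -c01) = zero-coords⇒≈0 λ m m<M → ℤP.neg-injective
      (binary-sum-∣ M (λ m m<M → flip (-c01 (suc m) (s≤s z≤n) (s≤s m<M)))
                      (subst (+ N ∣_) (sym (∑<-neg M c)) (∣m⇒∣-m N∣∑c)) m m<M)

  coeffs-autocorrelation : ∀ a → coeffs (_·_ N a (conj N a)) ≗ coeffs a ⊛ reflect (coeffs a)
  coeffs-autocorrelation a n = trans (coeffs-· a (conj N a) n) (⊛-cong {coeffs a} (λ _ → refl) (coeffs-conj a) n)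

  coeffs-autocorrelation-· : ∀ β γ → let b = coeffs β ; g = coeffs γ in
    coeffs (_·_ N (_·_ N β γ) (conj N (_·_ N β γ))) ≗ (b ⊛ reflect b) ⊛ (g ⊛ reflect g)
  coeffs-autocorrelation-· β γ n = begin
    coeffs (_·_ N βγ (conj N βγ)) n           ≡⟨ coeffs-autocorrelation βγ n ⟩
    (coeffs βγ ⊛ reflect (coeffs βγ)) n       ≡⟨ ⊛-cong (coeffs-· β γ) (coeffs-· β γ ∘ (M ℕ.*_)) n ⟩
    ((b ⊛ g) ⊛ reflect (b ⊛ g)) n             ≡⟨ ⊛-cong {b ⊛ g} (λ _ → refl) (reflect-⊛ b-per g-per) n ⟩
    ((b ⊛ g) ⊛ (reflect b ⊛ reflect g)) n
      ≡⟨ ⊛-interchange {b} g-per (periodic-reflect b-per) (periodic-reflect g-per) n ⟩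
    ((b ⊛ reflect b) ⊛ (g ⊛ reflect g)) n     ∎
    where
    open ≡-Reasoning
    βγ = _·_ N β γ
    b = coeffs β
    g = coeffs γ
    b-per = periodic-coeffs β
    g-per = periodic-coeffs γ

  autocorrelation-cancel : Prime N → N % 2 ≡ 1 → ∀ β γ → ¬ (+ N ∣ ∑< N (coeffs β)) →
    _≈_ N (_·_ N β (conj N β)) (_·_ N (_·_ N β γ) (conj N (_·_ N β γ))) →
    _≈_ N (_·_ N γ (conj N γ)) (ζ^ N 0)
  autocorrelation-cancel N-prime N-odd β γ N∤∑b autocorr =
    coeffs-diff-const⇒≈ {_·_ N γ (conj N γ)} {ζ^ N 0} λ n _ → begin
    coeffs (_·_ N γ (conj N γ)) n - δ n    ≡⟨ cong (_- δ n) (coeffs-autocorrelation γ n) ⟩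
    d n                                    ≡⟨ d-const n ⟩
    d 0                                    ≡⟨ cong (_- δ 0) (coeffs-autocorrelation γ 0) ⟨
    coeffs (_·_ N γ (conj N γ)) 0 - δ 0    ∎
    where
    open ≡-Reasoning
    b = coeffs β
    g = coeffs γ
    δ = coeffs (ζ^ N 0)
    A = b ⊛ reflect b
    G = g ⊛ reflect g
    A-per : Periodic A
    A-per = periodic-⊛ b (periodic-reflect (periodic-coeffs β))
    d : ℕ → ℤ
    d n = G n - δ n
    d-per : Periodic d
    d-per = periodic-- (periodic-⊛ g (periodic-reflect (periodic-coeffs γ))) (periodic-coeffs (ζ^ N 0))
    N∤∑A : ¬ (+ N ∣ ∑< N A)
    N∤∑A N∣∑A = N∤∑b (reduce (euclidsLemmaℤ N-prime (∑< N b) (∑< N b)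
      (subst (+ N ∣_) (trans (∑-⊛ b (periodic-reflect (periodic-coeffs β)))
                             (cong (∑< N b *_) (∑-reflect (periodic-coeffs β)))) N∣∑A)))
    X Y : Elt N
    X = _·_ N (_·_ N β γ) (conj N (_·_ N β γ))
    Y = _·_ N β (conj N β)
    A⊛d≡ : ∀ n → (A ⊛ d) n ≡ coeffs X n - coeffs Y n
    A⊛d≡ n = trans (⊛-distrib-- A G δ n)
      (cong₂ _-_ (sym (coeffs-autocorrelation-· β γ n))
                 (trans (⊛-ζ^0 A-per n) (sym (coeffs-autocorrelation β n))))
    A⊛d-const : ∀ n → (A ⊛ d) n ≡ (A ⊛ d) 0
    A⊛d-const n = trans (A⊛d≡ n) (trans (≈⇒coeffs-diff-const {X} {Y} (≈-sym {Y} {X} autocorr) n) (sym (A⊛d≡ 0)))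
    d-const : ∀ n → d n ≡ d 0
    d-const = ⊛-const⇒const N-prime N-odd {A} N∤∑A d-per A⊛d-const

  supported-at⇒ζ^ : ∀ (x : Elt N) j ε → x j ≡ ε → (∀ i → i ≢ j → x i ≡ 0ℤ) → ∀ i → x i ≡ ε * ζ^ N (toℕ j) i
  supported-at⇒ζ^ x j ε xj≡ε others i with i FinP.≟ j
  ... | yes refl = trans xj≡ε (trans (sym (ℤP.*-identityʳ ε))
                     (cong (ε *_) (sym (subst (λ l → ζ^ N (toℕ j) l ≡ 1ℤ) (idx-toℕ j) (ζ^-at-idx (toℕ j))))))
  ... | no i≢j   = trans (others i i≢j) (trans (sym (ℤP.*-zeroʳ ε))
                     (cong (ε *_) (sym (ζ^-off-idx (toℕ j) i (λ i≡ → i≢j (trans i≡ (idx-toℕ j)))))))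

  -- The constant coefficient vector represents 0 in O.
  shift⇒≈ : ∀ {a b : Elt N} t → (∀ l → a l - t ≡ b l) → _≈_ N a b
  shift⇒≈ {a} {b} t a-t≡b i _ _ =
    trans (cancel-shift (a (idx N i)) (a (idx N 0)) t) (cong₂ _-_ (a-t≡b (idx N i)) (a-t≡b (idx N 0)))
    where
    cancel-shift : ∀ x y t → x - y ≡ (x - t) - (y - t)
    cancel-shift = ℤSolver.solve-∀

  unit-shift⇒±ζ^ : ∀ γ t → ∑< N (λ m → (coeffs γ m - t) * (coeffs γ m - t)) ≡ 1ℤ →
                   ∃ λ k → _≈_ N γ (ζ^ N k) ⊎ _≈_ N γ (negᴼ N (ζ^ N k))
  unit-shift⇒±ζ^ γ t ∑≡1 = conclude (sum-squares≡1ℤ x ∑x²≡1)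
    where
    x : Elt N
    x i = γ i - t
    ∑x²≡1 : sum (λ i → x i * x i) ≡ 1ℤ
    ∑x²≡1 = trans (sum-cong-≗ {N} (λ i → cong (λ l → (γ l - t) * (γ l - t)) (sym (idx-toℕ i)))) ∑≡1
    conclude : (∃ λ j → (x j ≡ 1ℤ ⊎ x j ≡ -1ℤ) × ∀ i → i ≢ j → x i ≡ 0ℤ) →
               ∃ λ k → _≈_ N γ (ζ^ N k) ⊎ _≈_ N γ (negᴼ N (ζ^ N k))
    conclude (j , inj₁ xj≡1 , others) = toℕ j , inj₁ (shift⇒≈ {γ} {ζ^ N (toℕ j)} t λ l →
      trans (supported-at⇒ζ^ x j 1ℤ xj≡1 others l) (ℤP.*-identityˡ (ζ^ N (toℕ j) l)))
    conclude (j , inj₂ xj≡-1 , others) = toℕ j , inj₂ (shift⇒≈ {γ} {negᴼ N (ζ^ N (toℕ j))} t λ l →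
      trans (supported-at⇒ζ^ x j -1ℤ xj≡-1 others l) (ℤP.-1*i≡-i (ζ^ N (toℕ j) l)))

  norm-one⇒±ζ^ : Prime N → ∀ γ → _≈_ N (_·_ N γ (conj N γ)) (ζ^ N 0) →
                 ∃ λ k → _≈_ N γ (ζ^ N k) ⊎ _≈_ N γ (negᴼ N (ζ^ N k))
  norm-one⇒±ζ^ N-prime γ γγ̄≈1 =
    let ε , t , ε²≡1 , s≡ε+tN = square≡1-mod-prime {N} {c} {s} N-prime Nc≡s²-1
    in unit-shift⇒±ζ^ γ t (trans (∑<-shifted-squares N g t)
                                 (shifted-norm≡1 N {c} {s} {t} {ε} ε²≡1 s≡ε+tN Nc≡s²-1 Q≡1+c))
    where
    open ≡-Reasoning
    g = coeffs γ
    g-per = periodic-coeffs γ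
    G = g ⊛ reflect g
    δ = coeffs (ζ^ N 0)
    s = ∑< N g
    c = G 0 - 1ℤ
    G-δ≡c : ∀ n → G n - δ n ≡ c
    G-δ≡c n = begin
      G n - δ n                              ≡⟨ cong (_- δ n) (coeffs-autocorrelation γ n) ⟨
      coeffs (_·_ N γ (conj N γ)) n - δ n    ≡⟨ ≈⇒coeffs-diff-const {_·_ N γ (conj N γ)} {ζ^ N 0} γγ̄≈1 n ⟩
      coeffs (_·_ N γ (conj N γ)) 0 - δ 0    ≡⟨ cong₂ _-_ (coeffs-autocorrelation γ 0) (ζ^-at-idx 0) ⟩
      c                                      ∎
    Nc≡s²-1 : + N * c ≡ s * s - 1ℤ
    Nc≡s²-1 = begin
      + N * c                        ≡⟨ ∑<-const N c ⟨
      ∑< N (λ _ → c)                 ≡⟨ ∑<-cong-≗ N G-δ≡c ⟨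
      ∑< N (λ n → G n - δ n)         ≡⟨ ∑<-distrib-- N G δ ⟩
      ∑< N G - ∑< N δ                ≡⟨ cong₂ _-_ (∑-⊛ g (periodic-reflect g-per)) ∑-ζ^0 ⟩
      s * ∑< N (reflect g) - 1ℤ      ≡⟨ cong (λ x → s * x - 1ℤ) (∑-reflect g-per) ⟩
      s * s - 1ℤ                     ∎
    reflect² : ∀ M m → M ℕ.* (0 ℕ.+ M ℕ.* m) ℕ.+ m ℕ.* suc M ≡ m ℕ.+ M ℕ.* m ℕ.* suc M
    reflect² = ℕSolver.solve-∀
    restore : ∀ x → x ≡ 1ℤ + (x - 1ℤ)
    restore = ℤSolver.solve-∀
    Q≡1+c : ∑< N (λ m → g m * g m) ≡ 1ℤ + c
    Q≡1+c = begin
      ∑< N (λ m → g m * g m)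
        ≡⟨ ∑<-cong-≗ N (λ m → cong (g m *_) (periodic-cong g-per m (M ℕ.* m) (reflect² M m))) ⟨
      G 0
        ≡⟨ restore (G 0) ⟩
      1ℤ + c ∎

lemma1 : (N : ℕ) .{{_ : NonZero N}} → Prime N → N % 2 ≡ 1 →
    (β γ : Elt N) →
    IsBinary N β → IsBinary N (_·_ N β γ) →
    _≈_ N (_·_ N β (conj N β)) (_·_ N (_·_ N β γ) (conj N (_·_ N β γ))) →
    ∃ λ (k : ℕ) → _≈_ N γ (ζ^ N k) ⊎ _≈_ N γ (negᴼ N (ζ^ N k))
lemma1 zero    N-prime = ⊥-elim (¬prime[0] N-prime)
lemma1 (suc M) N-prime N-odd β γ β-binary _ autocorr =
  norm-one⇒±ζ^ N-prime γ (autocorrelation-cancel N-prime N-odd β γ (binary⇒N∤∑ β β-binary) autocorr)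
  where open Cyclotomic M
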